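{- Let $\mathcal{H}$ be a graded connected Hopf algebra over a field $k$ of characteristic different from $2$. Let $\varphi,\psi:\mathcal{H}\to k$ be two linear functionals such that $\varphi_0=\psi_0=\epsilon$. \begin{itemize} \item[(a)] There is a unique linear functional $\rho:\mathcal{H}\to k$ such that $\varphi=\rho\psi\rho$ and $\rho_0=\epsilon$. \item[(b)] If $\varphi$ and $\psi$ are characters then so is $\rho$. \item[(c)] If $\overline{\varphi}=\psi^{ -1}$ then $\rho$ is even and if $\overline{\varphi}=\psi$ then $\rho$ is odd. \end{itemize}
   Context: $\mathcal{H}=\bigoplus_{n\ge0}\mathcal{H}_n$ with $\mathcal{H}_0=k\cdot1$ and each $\mathcal{H}_n$ finite-dimensional. For a linear functional $\varphi$, $\varphi_n:=\varphi|_{\mathcal{H}_n}$. Products of functionals are convolution products $\varphi\psi=m_k\circ(\varphi\otimes\psi)\circ\Delta_{\mathcal{H}}$, with unit the counit $\epsilon$; a character is an algebra morphism $\mathcal{H}\to k$, and the inverse of a character is $\varphi\circ S_{\mathcal{H}}$. For $h\in\mathcal{H}_n$, $\overline{\varphi}(h)=(-1)^n\varphi(h)$. A character $\rho$ is even if $\overline{\rho}=\rho$ and odd if $\overline{\rho}=\rho^{ -1}$. -}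

module Defs where

open import Level using (Level; _⊔_)
open import Data.Nat as ℕ using (ℕ; zero; suc) renaming (_+_ to _+ℕ_)
open import Data.Fin using (Fin)
open import Data.Fin.Properties using () renaming (_≟_ to _≟ᶠ_)
open import Data.Product using (Σ; _,_; proj₁; proj₂; _×_)
open import Relation.Nullary using (¬_; yes; no)
open import Relation.Binary.PropositionalEquality using (_≡_; _≢_)
open import Algebra.Bundles using (CommutativeRing)

record Field (c ℓ : Level) : Set (Level.suc (c ⊔ ℓ)) where
  field
    commutativeRing : CommutativeRing c ℓ
  open CommutativeRing commutativeRing public
  field
    1≉0     : ¬ (1# ≈ 0#)
    inverse : ∀ x → ¬ (x ≈ 0#) → Σ Carrier (λ y → x * y ≈ 1#)

module Over {c ℓ : Level} (k : Field c ℓ) where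
  open Field k renaming (Carrier to K) hiding (zero)

  CharNot2 : Set ℓ
  CharNot2 = ¬ (1# + 1# ≈ 0#)

  ΣFin : (n : ℕ) → (Fin n → K) → K
  ΣFin zero    f = 0#
  ΣFin (suc n) f = f Fin.zero + ΣFin n (λ i → f (Fin.suc i))
    where import Data.Fin as Fin

  -- A graded connected Hopf algebra H = ⊕ H_n over k with each H_n
  -- finite dimensional, presented through a homogeneous basis and its
  -- structure constants.  H_n has dimension  dim n ; connectedness is
  -- built in: dim 0 = 1, and the basis vector of H_0 is the unit 1.
  -- A basis element is a pair (n , i) with i : Fin (dim n), of degree n.

  module Graded (dim₊ : ℕ → ℕ) where
    dim : ℕ → ℕ
    dim zero    = 1
    dim (suc n) = dim₊ n

    Basis : Set
    Basis = Σ ℕ (λ n → Fin (dim n))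

    deg : Basis → ℕ
    deg = proj₁

    one : Basis
    one = (0 , Fin.zero)
      where import Data.Fin as Fin

    δ : Basis → Basis → K
    δ (m , i) (n , j) with m ℕ.≟ n
    ... | no _ = 0#
    ... | yes _≡_.refl with i ≟ᶠ j
    ...   | yes _ = 1#
    ...   | no  _ = 0#

    ε : Basis → K
    ε (zero  , _) = 1#
    ε (suc _ , _) = 0#

    Σdeg : ℕ → (Basis → K) → K
    Σdeg n f = ΣFin (dim n) (λ i → f (n , i))

    Σ≤ : ℕ → (Basis → K) → K
    Σ≤ zero    f = Σdeg zero f
    Σ≤ (suc n) f = Σ≤ n f + Σdeg (suc n) f


  record GradedConnectedHopfAlgebra (dim₊ : ℕ → ℕ) : Set (c ⊔ ℓ) where
    open Graded dim₊
    field
      -- x · y = Σ_w  mult x y w · w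
      mult   : Basis → Basis → Basis → K
      -- Δ b = Σ_{u,v} comult b u v · u ⊗ v
      comult : Basis → Basis → Basis → K
      -- S b = Σ_w antipode b w · w
      antipode : Basis → Basis → K

      mult-graded     : ∀ x y w → deg w ≢ deg x +ℕ deg y → mult x y w ≈ 0#
      comult-graded   : ∀ b u v → deg u +ℕ deg v ≢ deg b → comult b u v ≈ 0#
      antipode-graded : ∀ b w → deg w ≢ deg b → antipode b w ≈ 0#

      mult-assoc : ∀ x y z w →
        Σdeg (deg x +ℕ deg y) (λ c → mult x y c * mult c z w)
          ≈ Σdeg (deg y +ℕ deg z) (λ c → mult y z c * mult x c w)
      mult-unitˡ : ∀ x w → mult one x w ≈ δ x w
      mult-unitʳ : ∀ x w → mult x one w ≈ δ x w

      comult-coassoc : ∀ b x y z →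
        Σdeg (deg x +ℕ deg y) (λ c → comult b c z * comult c x y)
          ≈ Σdeg (deg y +ℕ deg z) (λ c → comult b x c * comult c y z)
      counitˡ : ∀ b v → comult b one v ≈ δ b v
      counitʳ : ∀ b u → comult b u one ≈ δ b u

      -- bialgebra: Δ(xy) = Δ(x)Δ(y)
      -- (ε is multiplicative and Δ(1) = 1 ⊗ 1 follow from the above)
      comult-mult : ∀ x y u v →
        Σdeg (deg x +ℕ deg y) (λ c → mult x y c * comult c u v)
          ≈ Σ≤ (deg x) (λ x₁ → Σ≤ (deg x) (λ x₂ →
              Σ≤ (deg y) (λ y₁ → Σ≤ (deg y) (λ y₂ →
                comult x x₁ x₂ * comult y y₁ y₂
                  * (mult x₁ y₁ u * mult x₂ y₂ v)))))

      antipodeˡ : ∀ b w →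
        Σ≤ (deg b) (λ x₁ → Σ≤ (deg b) (λ x₂ → Σdeg (deg x₁) (λ c →
          comult b x₁ x₂ * (antipode x₁ c * mult c x₂ w))))
          ≈ ε b * δ one w
      antipodeʳ : ∀ b w →
        Σ≤ (deg b) (λ x₁ → Σ≤ (deg b) (λ x₂ → Σdeg (deg x₂) (λ c →
          comult b x₁ x₂ * (antipode x₂ c * mult x₁ c w))))
          ≈ ε b * δ one w


  module HopfAlgebra {dim₊ : ℕ → ℕ} (H : GradedConnectedHopfAlgebra dim₊) where
    open Graded dim₊ public
    open GradedConnectedHopfAlgebra H public

    -- Linear functionals H → k, given by their values on the basis.

    Functional : Set c
    Functional = Basis → K

    _≋_ : Functional → Functional → Set ℓ
    φ ≋ ψ = ∀ b → φ b ≈ ψ b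

    RestrictsToε : Functional → Set ℓ
    RestrictsToε φ = ∀ (i : Fin (dim 0)) → φ (0 , i) ≈ ε (0 , i)

    _⋆_ : Functional → Functional → Functional
    (φ ⋆ ψ) b = Σ≤ (deg b) (λ u → Σ≤ (deg b) (λ v →
                  comult b u v * (φ u * ψ v)))

    sign : ℕ → K → K
    sign zero    a = a
    sign (suc n) a = - sign n a

    bar : Functional → Functional
    bar φ b = sign (deg b) (φ b)

    IsInverse : Functional → Functional → Set ℓ
    IsInverse φ χ = ((φ ⋆ χ) ≋ ε) × ((χ ⋆ φ) ≋ ε)

    IsCharacter : Functional → Set ℓ
    IsCharacter ρ = (ρ one ≈ 1#) ×
      (∀ x y → Σdeg (deg x +ℕ deg y) (λ c → mult x y c * ρ c) ≈ ρ x * ρ y)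

    IsEven : Functional → Set ℓ
    IsEven ρ = bar ρ ≋ ρ

    IsOdd : Functional → Set ℓ
    IsOdd ρ = IsInverse ρ (bar ρ)

-- In the convolution algebra of a graded connected coalgebra, an equation T f = t in which the
-- degree-(n+1) part of T f is T (f truncated to degrees ≤ n) plus γ times f, with γ invertible, has
-- exactly one solution with f₀ = ε: solve it degree by degree.  For the sandwich T f = f ψ f the top
-- part of f enters once from each outer factor, so γ = 2, and this is where char k ≠ 2 is needed.
-- (b) is uniqueness in the convolution algebra of H ⊗ H: pulling back along the multiplication
-- (Δ is an algebra map) and taking tensor products are convolution morphisms, so ρ ∘ m and ρ ⊗ ρ
-- both solve the sandwich equation for ψ ∘ m = ψ ⊗ ψ with right-hand side φ ∘ m = φ ⊗ φ.
-- (c) is uniqueness again: φ ↦ φ̄ is a convolution automorphism, so under the two hypotheses ρ̄,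
-- respectively the inverse of ρ̄, solves the equation that defines ρ.

module Submission where

open import Level using (_⊔_; 0ℓ)
open import Data.Nat as ℕ using (ℕ; zero; suc; _≤_; _≤?_; z≤n) renaming (_+_ to _+ℕ_)
import Data.Nat.Properties as ℕₚ
open import Data.Fin as Fin using (Fin)
open import Data.Fin.Properties using (suc-injective) renaming (_≟_ to _≟ᶠ_)
open import Data.Product using (Σ; _,_; proj₁; proj₂; _×_)
open import Data.Sum using (_⊎_; inj₁; inj₂)
open import Function using (_∘_)
open import Relation.Nullary using (¬_; yes; no; Dec; contradiction)
open import Relation.Binary.PropositionalEquality as ≡ using (_≡_; _≢_)
open import Relation.Binary.Bundles using (Setoid)
open import Algebra.Bundles using (Monoid)
open import Defs
import Algebra.Solver.CommutativeMonoid
import Algebra.Properties.Monoid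

m≡1+n⇒m≰n : ∀ {m n} → m ≡ suc n → ¬ m ≤ n
m≡1+n⇒m≰n m≡1+n m≤n = ℕₚ.<⇒≱ (ℕₚ.≤-reflexive (≡.sym m≡1+n)) m≤n

m≤1+n∧m≰n⇒m≡1+n : ∀ {m n} → m ≤ suc n → ¬ m ≤ n → m ≡ suc n
m≤1+n∧m≰n⇒m≡1+n m≤1+n m≰n = ℕₚ.≤-antisym m≤1+n (ℕₚ.≰⇒> m≰n)

+-≢-suc : ∀ a b n → ¬ a ≤ n → b ≢ 0 → a +ℕ b ≢ suc n
+-≢-suc a b n a≰n b≢0 a+b≡1+n = b≢0 (ℕₚ.n≤0⇒n≡0 (ℕₚ.+-cancelˡ-≤ a b 0
  (ℕₚ.≤-trans (ℕₚ.≤-reflexive a+b≡1+n) (ℕₚ.≤-trans (ℕₚ.≰⇒> a≰n) (ℕₚ.≤-reflexive (≡.sym (ℕₚ.+-identityʳ a)))))))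

module Scalars {c ℓ} (k : Field c ℓ) where
  open Field k public renaming (Carrier to K) hiding (zero)
  module +-Solver = Algebra.Solver.CommutativeMonoid +-commutativeMonoid
  module *-Solver = Algebra.Solver.CommutativeMonoid *-commutativeMonoid
  open import Algebra.Properties.CommutativeSemigroup +-commutativeSemigroup public
    using () renaming (interchange to +-interchange)
  open import Algebra.Properties.Group +-group public
    using () renaming (∙-cancelˡ to +-cancelˡ)
  open import Algebra.Properties.AbelianGroup +-abelianGroup public
    using () renaming (xyx⁻¹≈y to x+y-x≈y)

  x≈0⇒x*y≈0 : ∀ {x} y → x ≈ 0# → x * y ≈ 0#
  x≈0⇒x*y≈0 y x≈0 = trans (*-congʳ x≈0) (zeroˡ y)

  y≈0⇒x*y≈0 : ∀ x {y} → y ≈ 0# → x * y ≈ 0#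
  y≈0⇒x*y≈0 x y≈0 = trans (*-congˡ y≈0) (zeroʳ x)

  infix 0 ifᵈ_then_else_
  ifᵈ_then_else_ : ∀ {p} {A : Set p} → Dec A → K → K → K
  ifᵈ yes _ then a else b = a
  ifᵈ no _  then a else b = b

  ifᵈ-yes : ∀ {p} {A : Set p} (d : Dec A) {a b} → A → (ifᵈ d then a else b) ≈ a
  ifᵈ-yes (yes _) _ = refl
  ifᵈ-yes (no ¬x) x = contradiction x ¬x

  ifᵈ-no : ∀ {p} {A : Set p} (d : Dec A) {a b} → ¬ A → (ifᵈ d then a else b) ≈ b
  ifᵈ-no (yes x) ¬x = contradiction x ¬x
  ifᵈ-no (no _)  _  = refl

module FiniteSums {c ℓ} (k : Field c ℓ) where
  open Scalars k
  open Over k using (ΣFin)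
  open import Algebra.Properties.Semiring.Sum semiring
  open import Relation.Binary.Reasoning.Setoid setoid

  ΣFin≡sum : ∀ n f → ΣFin n f ≡ sum f
  ΣFin≡sum zero    f = ≡.refl
  ΣFin≡sum (suc n) f = ≡.cong (f Fin.zero +_) (ΣFin≡sum n (f ∘ Fin.suc))

  private
    via-sum : ∀ n {f g : Fin n → K} → sum f ≈ sum g → ΣFin n f ≈ ΣFin n g
    via-sum n {f} {g} eq = begin
      ΣFin n f ≡⟨ ΣFin≡sum n f ⟩
      sum f    ≈⟨ eq ⟩
      sum g    ≡⟨ ΣFin≡sum n g ⟨
      ΣFin n g ∎

  ΣFin-cong : ∀ n {f g : Fin n → K} → (∀ i → f i ≈ g i) → ΣFin n f ≈ ΣFin n g
  ΣFin-cong n f≈g = via-sum n (sum-cong-≋ f≈g)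

  ΣFin-+ : ∀ n (f g : Fin n → K) → ΣFin n (λ i → f i + g i) ≈ ΣFin n f + ΣFin n g
  ΣFin-+ n f g = begin
    ΣFin n (λ i → f i + g i) ≡⟨ ΣFin≡sum n _ ⟩
    sum (λ i → f i + g i)    ≈⟨ ∑-distrib-+ f g ⟩
    sum f + sum g            ≡⟨ ≡.cong₂ _+_ (ΣFin≡sum n f) (ΣFin≡sum n g) ⟨
    ΣFin n f + ΣFin n g      ∎

  ΣFin-* : ∀ n a (f : Fin n → K) → ΣFin n (λ i → a * f i) ≈ a * ΣFin n f
  ΣFin-* n a f = begin
    ΣFin n (λ i → a * f i) ≡⟨ ΣFin≡sum n _ ⟩
    sum (λ i → a * f i)    ≈⟨ *-distribˡ-sum a f ⟨
    a * sum f              ≡⟨ ≡.cong (a *_) (ΣFin≡sum n f) ⟨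
    a * ΣFin n f           ∎

  ΣFin-0 : ∀ n {f : Fin n → K} → (∀ i → f i ≈ 0#) → ΣFin n f ≈ 0#
  ΣFin-0 n {f} f≈0 = begin
    ΣFin n f ≡⟨ ΣFin≡sum n f ⟩
    sum f    ≈⟨ sum-cong-≋ {n} f≈0 ⟩
    sum {n} (λ _ → 0#) ≈⟨ sum-replicate-zero n ⟩
    0#       ∎

  record LinearForm {a} (A : Set a) : Set (a ⊔ c ⊔ ℓ) where
    field
      apply : (A → K) → K
      apply-cong : ∀ {F G} → (∀ x → F x ≈ G x) → apply F ≈ apply G
      apply-+ : ∀ F G → apply (λ x → F x + G x) ≈ apply F + apply G
      apply-* : ∀ a F → apply (λ x → a * F x) ≈ a * apply F

    apply-0 : ∀ {F} → (∀ x → F x ≈ 0#) → apply F ≈ 0#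
    apply-0 F≈0 = begin
      apply _               ≈⟨ apply-cong (λ x → trans (F≈0 x) (sym (zeroˡ 0#))) ⟩
      apply (λ _ → 0# * 0#) ≈⟨ apply-* 0# (λ _ → 0#) ⟩
      0# * apply (λ _ → 0#) ≈⟨ zeroˡ _ ⟩
      0#                    ∎

    apply-*ʳ : ∀ F a → apply (λ x → F x * a) ≈ apply F * a
    apply-*ʳ F a = trans (apply-cong (λ x → *-comm (F x) a)) (trans (apply-* a F) (*-comm a (apply F)))
  open LinearForm public

  apply-product : ∀ {a b} {A : Set a} {B : Set b} (L₁ : LinearForm A) (L₂ : LinearForm B) P Q →
    apply L₁ (λ x → apply L₂ (λ y → P x * Q y)) ≈ apply L₁ P * apply L₂ Q
  apply-product L₁ L₂ P Q = trans (apply-cong L₁ (λ x → apply-* L₂ (P x) Q)) (apply-*ʳ L₁ P (apply L₂ Q))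

  apply-ΣFin : ∀ {a} {A : Set a} (L : LinearForm A) n (F : A → Fin n → K) →
    apply L (λ x → ΣFin n (F x)) ≈ ΣFin n (λ i → apply L (λ x → F x i))
  apply-ΣFin L zero    F = apply-0 L (λ _ → refl)
  apply-ΣFin L (suc n) F = trans (apply-+ L _ _) (+-congˡ (apply-ΣFin L n _))

  ΣFin-single : ∀ n (i : Fin n) {f : Fin n → K} → (∀ j → j ≢ i → f j ≈ 0#) → ΣFin n f ≈ f i
  ΣFin-single (suc n) Fin.zero    f≈0 =
    trans (+-congˡ (ΣFin-0 n (λ j → f≈0 (Fin.suc j) (λ ())))) (+-identityʳ _)
  ΣFin-single (suc n) (Fin.suc i) f≈0 =
    trans (+-cong (f≈0 Fin.zero (λ ())) (ΣFin-single n i (λ j j≢i → f≈0 (Fin.suc j) (j≢i ∘ suc-injective))))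
          (+-identityˡ _)

module GradedSums {c ℓ} (k : Field c ℓ) (dim₊ : ℕ → ℕ) where
  open Scalars k
  open FiniteSums k
  open Over.Graded k dim₊
  open import Relation.Binary.Reasoning.Setoid setoid

  Σdeg-cong : ∀ n {F G} → (∀ u → deg u ≡ n → F u ≈ G u) → Σdeg n F ≈ Σdeg n G
  Σdeg-cong n F≈G = ΣFin-cong (dim n) (λ i → F≈G (n , i) ≡.refl)

  Σdeg-0 : ∀ n {F} → (∀ u → deg u ≡ n → F u ≈ 0#) → Σdeg n F ≈ 0#
  Σdeg-0 n F≈0 = ΣFin-0 (dim n) (λ i → F≈0 (n , i) ≡.refl)

  Σdeg-linear : ∀ n → LinearForm Basis
  Σdeg-linear n = record
    { apply = Σdeg n ; apply-cong = λ F≈G → Σdeg-cong n (λ u _ → F≈G u)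
    ; apply-+ = λ F G → ΣFin-+ (dim n) _ _ ; apply-* = λ a F → ΣFin-* (dim n) a _ }

  Σ≤-cong : ∀ n {F G} → (∀ u → deg u ≤ n → F u ≈ G u) → Σ≤ n F ≈ Σ≤ n G
  Σ≤-cong zero    F≈G = Σdeg-cong 0 (λ u u≡0 → F≈G u (ℕₚ.≤-reflexive u≡0))
  Σ≤-cong (suc n) F≈G = +-cong (Σ≤-cong n (λ u u≤n → F≈G u (ℕₚ.m≤n⇒m≤1+n u≤n)))
                               (Σdeg-cong (suc n) (λ u u≡n → F≈G u (ℕₚ.≤-reflexive u≡n)))

  Σ≤-+ : ∀ n F G → Σ≤ n (λ u → F u + G u) ≈ Σ≤ n F + Σ≤ n G
  Σ≤-+ zero    F G = apply-+ (Σdeg-linear 0) F G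
  Σ≤-+ (suc n) F G = trans (+-cong (Σ≤-+ n F G) (apply-+ (Σdeg-linear (suc n)) F G))
                           (+-interchange _ _ _ _)

  Σ≤-* : ∀ n a F → Σ≤ n (λ u → a * F u) ≈ a * Σ≤ n F
  Σ≤-* zero    a F = apply-* (Σdeg-linear 0) a F
  Σ≤-* (suc n) a F = trans (+-cong (Σ≤-* n a F) (apply-* (Σdeg-linear (suc n)) a F)) (sym (distribˡ _ _ _))

  Σ≤-linear : ∀ n → LinearForm Basis
  Σ≤-linear n = record
    { apply = Σ≤ n ; apply-cong = λ F≈G → Σ≤-cong n (λ u _ → F≈G u) ; apply-+ = Σ≤-+ n ; apply-* = Σ≤-* n }

  Σ≤-0 : ∀ n {F} → (∀ u → deg u ≤ n → F u ≈ 0#) → Σ≤ n F ≈ 0#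
  Σ≤-0 n F≈0 = trans (Σ≤-cong n F≈0) (apply-0 (Σ≤-linear n) (λ _ → refl))

  apply-Σ≤ : ∀ {a} {A : Set a} (L : LinearForm A) n (F : A → Basis → K) →
    apply L (λ x → Σ≤ n (F x)) ≈ Σ≤ n (λ u → apply L (λ x → F x u))
  apply-Σ≤ L zero    F = apply-ΣFin L (dim 0) (λ x i → F x (0 , i))
  apply-Σ≤ L (suc n) F =
    trans (apply-+ L _ _) (+-cong (apply-Σ≤ L n F) (apply-ΣFin L (dim (suc n)) (λ x i → F x (suc n , i))))

  Σ≤-swap : ∀ m n (F : Basis → Basis → K) →
    Σ≤ m (λ x → Σ≤ n (F x)) ≈ Σ≤ n (λ y → Σ≤ m (λ x → F x y))
  Σ≤-swap m = apply-Σ≤ (Σ≤-linear m)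

  Σ≤-concentrated : ∀ n d {F} → d ≤ n → (∀ u → deg u ≢ d → F u ≈ 0#) → Σ≤ n F ≈ Σdeg d F
  Σ≤-concentrated zero    d d≤0 F≈0 with ℕₚ.n≤0⇒n≡0 d≤0
  ... | ≡.refl = refl
  Σ≤-concentrated (suc n) d d≤1+n F≈0 with d ≤? n
  ... | yes d≤n = trans (+-cong (Σ≤-concentrated n d d≤n F≈0)
                                (Σdeg-0 (suc n) (λ u u≡1+n → F≈0 u (λ { ≡.refl → m≡1+n⇒m≰n u≡1+n d≤n }))))
                        (+-identityʳ _)
  ... | no d≰n with m≤1+n∧m≰n⇒m≡1+n d≤1+n d≰n
  ...   | ≡.refl = trans (+-congʳ (Σ≤-0 n (λ u u≤n → F≈0 u (λ { ≡.refl → d≰n u≤n })))) (+-identityˡ _)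

  Σ≤-single : ∀ n b {F} → deg b ≤ n → (∀ u → u ≢ b → F u ≈ 0#) → Σ≤ n F ≈ F b
  Σ≤-single n (m , i) m≤n F≈0 =
    trans (Σ≤-concentrated n m m≤n (λ u u≢m → F≈0 u (u≢m ∘ ≡.cong deg)))
          (ΣFin-single (dim m) i (λ j j≢i → F≈0 (m , j) (λ { ≡.refl → j≢i ≡.refl })))

  deg≡0⇒≡one : ∀ u → deg u ≡ 0 → u ≡ one
  deg≡0⇒≡one (zero , Fin.zero) _ = ≡.refl

  Σ≤-unit : ∀ n {F} → (∀ u → deg u ≢ 0 → F u ≈ 0#) → Σ≤ n F ≈ F one
  Σ≤-unit n F≈0 = Σ≤-single n one z≤n (λ u u≢one → F≈0 u (u≢one ∘ deg≡0⇒≡one u))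

  δ-refl : ∀ b → δ b b ≈ 1#
  δ-refl (m , i) with m ℕ.≟ m
  ... | no m≢m = contradiction ≡.refl m≢m
  ... | yes ≡.refl with i ≟ᶠ i
  ...   | yes _   = refl
  ...   | no i≢i  = contradiction ≡.refl i≢i

  δ-≢ : ∀ b u → b ≢ u → δ b u ≈ 0#
  δ-≢ (m , i) (n , j) b≢u with m ℕ.≟ n
  ... | no _ = refl
  ... | yes ≡.refl with i ≟ᶠ j
  ...   | yes ≡.refl = contradiction ≡.refl b≢u
  ...   | no _       = refl

  Σ≤-δ : ∀ n (b : Basis) (F : Basis → K) → deg b ≤ n → Σ≤ n (λ u → δ b u * F u) ≈ F b
  Σ≤-δ n b F b≤n = trans (Σ≤-single n b {λ u → δ b u * F u} b≤n (λ u u≢b → x≈0⇒x*y≈0 (F u) (δ-≢ b u (u≢b ∘ ≡.sym))))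
                         (trans (*-congʳ (δ-refl b)) (*-identityˡ (F b)))

  Σ≤-extend : ∀ m n {F} → m ≤ n → (∀ u → ¬ deg u ≤ m → F u ≈ 0#) → Σ≤ m F ≈ Σ≤ n F
  Σ≤-extend m zero    m≤0 F≈0 with ℕₚ.n≤0⇒n≡0 m≤0
  ... | ≡.refl = refl
  Σ≤-extend m (suc n) m≤1+n F≈0 with m ≤? n
  ... | yes m≤n = trans (Σ≤-extend m n m≤n F≈0) (trans (sym (+-identityʳ _))
                    (+-congˡ (sym (Σdeg-0 (suc n) (λ u u≡1+n → F≈0 u (λ u≤m → m≡1+n⇒m≰n u≡1+n (ℕₚ.≤-trans u≤m m≤n)))))))
  ... | no m≰n with m≤1+n∧m≰n⇒m≡1+n m≤1+n m≰n
  ...   | ≡.refl = refl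

  Σ≤-graded : ∀ n d {F} → (∀ u → deg u ≢ d → F u ≈ 0#) → (∀ u → ¬ deg u ≤ n → F u ≈ 0#) →
              Σ≤ n F ≈ Σdeg d F
  Σ≤-graded n d F≈0 F≈0-above with d ≤? n
  ... | yes d≤n = Σ≤-concentrated n d d≤n F≈0
  ... | no d≰n  = trans (Σ≤-0 n (λ u u≤n → F≈0 u (λ u≡d → d≰n (≡.subst (_≤ n) u≡d u≤n))))
                        (sym (Σdeg-0 d (λ u u≡d → F≈0-above u (λ u≤n → d≰n (≡.subst (_≤ n) u≡d u≤n)))))

  Σ≤-*ʳ : ∀ n F a → Σ≤ n (λ u → F u * a) ≈ Σ≤ n F * a
  Σ≤-*ʳ n = apply-*ʳ (Σ≤-linear n)

  Σ≤≤-linear : ∀ m n → LinearForm (Basis × Basis)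
  Σ≤≤-linear m n = record
    { apply      = λ F → Σ≤ m (λ x → Σ≤ n (λ y → F (x , y)))
    ; apply-cong = λ F≈G → Σ≤-cong m (λ x _ → Σ≤-cong n (λ y _ → F≈G (x , y)))
    ; apply-+    = λ F G → trans (Σ≤-cong m (λ x _ → Σ≤-+ n _ _)) (Σ≤-+ m _ _)
    ; apply-*    = λ a F → trans (Σ≤-cong m (λ x _ → Σ≤-* n a _)) (Σ≤-* m a _)
    }

  Σ≤-*-*ʳ : ∀ n a F b → a * (Σ≤ n F * b) ≈ Σ≤ n (λ u → a * (F u * b))
  Σ≤-*-*ʳ n a F b = trans (*-congˡ (sym (Σ≤-*ʳ n F b))) (sym (Σ≤-* n a _))

  Σ≤-*-*ˡ : ∀ n a b F → a * (b * Σ≤ n F) ≈ Σ≤ n (λ u → a * (b * F u))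
  Σ≤-*-*ˡ n a b F = trans (*-congˡ (sym (Σ≤-* n b F))) (sym (Σ≤-* n a _))

-- A coalgebra with a homogeneous basis indexed by Index: Δ b u v is the coefficient of u ⊗ v
-- in Δ b, and sumUpTo b sums over the basis elements of degree at most deg b.  Connectedness enters
-- as sumUpTo-unit: unit spans the degree-0 part.
record GradedCoalgebra {c ℓ} (k : Field c ℓ) : Set (Level.suc 0ℓ ⊔ c ⊔ ℓ) where
  open Field k renaming (Carrier to K)
  field
    Index        : Set
    deg          : Index → ℕ
    unit         : Index
    deg-unit     : deg unit ≡ 0
    sumUpTo      : Index → (Index → K) → K
    sumUpTo-cong : ∀ b {F G} → (∀ u → deg u ≤ deg b → F u ≈ G u) → sumUpTo b F ≈ sumUpTo b G
    sumUpTo-+    : ∀ b (F G : Index → K) → sumUpTo b (λ u → F u + G u) ≈ sumUpTo b F + sumUpTo b G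
    sumUpTo-*    : ∀ b a (F : Index → K) → sumUpTo b (λ u → a * F u) ≈ a * sumUpTo b F
    sumUpTo-unit : ∀ b {F} → (∀ u → deg u ≢ 0 → F u ≈ 0#) → sumUpTo b F ≈ F unit
    Δ            : Index → Index → Index → K
    Δ-graded     : ∀ b u v → deg u +ℕ deg v ≢ deg b → Δ b u v ≈ 0#
    Δ-counitˡ    : ∀ b (F : Index → K) → sumUpTo b (λ v → Δ b unit v * F v) ≈ F b
    Δ-counitʳ    : ∀ b (F : Index → K) → sumUpTo b (λ u → Δ b u unit * F u) ≈ F b

module Convolution {c ℓ} {k : Field c ℓ} (C : GradedCoalgebra k) where
  open Scalars k
  open GradedCoalgebra C
  open import Relation.Binary.Reasoning.Setoid setoid

  Functional : Set c
  Functional = Index → K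

  infix 4 _≋_
  _≋_ : Functional → Functional → Set ℓ
  f ≋ g = ∀ b → f b ≈ g b

  ≋-setoid : Setoid c ℓ
  ≋-setoid = record
    { Carrier       = Functional
    ; _≈_           = _≋_
    ; isEquivalence = record
      { refl  = λ _ → refl
      ; sym   = λ f≋g b → sym (f≋g b)
      ; trans = λ f≋g g≋h b → trans (f≋g b) (g≋h b)
      }
    }

  Unital : Functional → Set ℓ
  Unital f = ∀ u → deg u ≡ 0 → f u ≈ 1#

  IsCounit : Functional → Set ℓ
  IsCounit e = e unit ≈ 1# × (∀ u → deg u ≢ 0 → e u ≈ 0#)

  infixl 7 _⋆_
  _⋆_ : Functional → Functional → Functional
  (f ⋆ g) b = sumUpTo b (λ u → sumUpTo b (λ v → Δ b u v * (f u * g v)))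

  infixl 8 _↾_ _⇂_
  _↾_ _⇂_ : Functional → ℕ → Functional
  (f ↾ n) u = ifᵈ deg u ≤? n then f u else 0#
  (f ⇂ n) u = ifᵈ deg u ≤? n then 0# else f u

  module _ (f : Functional) {n : ℕ} {u : Index} where
    ↾-≤ : deg u ≤ n → (f ↾ n) u ≈ f u
    ↾-≤ = ifᵈ-yes (deg u ≤? n)

    ⇂-≰ : ¬ deg u ≤ n → (f ⇂ n) u ≈ f u
    ⇂-≰ = ifᵈ-no (deg u ≤? n)

  ↾+⇂ : ∀ f n u → f u ≈ (f ↾ n) u + (f ⇂ n) u
  ↾+⇂ f n u with deg u ≤? n
  ... | yes _ = sym (+-identityʳ (f u))
  ... | no _  = sym (+-identityˡ (f u))

  ↾-unital : ∀ {f} n → Unital f → Unital (f ↾ n)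
  ↾-unital {f} n f-unital u u≡0 = trans (↾-≤ f (ℕₚ.≤-trans (ℕₚ.≤-reflexive u≡0) z≤n)) (f-unital u u≡0)

  ↾-cong : ∀ {f g} n → (∀ u → deg u ≤ n → f u ≈ g u) → f ↾ n ≋ g ↾ n
  ↾-cong {f} {g} n f≈g u with deg u ≤? n
  ... | yes u≤n = f≈g u u≤n
  ... | no _    = refl

  ⋆-local : ∀ {f f′ g g′} b → (∀ u → deg u ≤ deg b → f u ≈ f′ u) → (∀ v → deg v ≤ deg b → g v ≈ g′ v) →
            (f ⋆ g) b ≈ (f′ ⋆ g′) b
  ⋆-local b f≈f′ g≈g′ =
    sumUpTo-cong b (λ u u≤b → sumUpTo-cong b (λ v v≤b → *-congˡ (*-cong (f≈f′ u u≤b) (g≈g′ v v≤b))))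

  ⋆-cong : ∀ {f f′ g g′} → f ≋ f′ → g ≋ g′ → f ⋆ g ≋ f′ ⋆ g′
  ⋆-cong f≈f′ g≈g′ b = ⋆-local b (λ u _ → f≈f′ u) (λ v _ → g≈g′ v)

  sumUpTo-0 : ∀ b {F} → (∀ u → F u ≈ 0#) → sumUpTo b F ≈ 0#
  sumUpTo-0 b F≈0 = begin
    sumUpTo b _               ≈⟨ sumUpTo-cong b (λ u _ → trans (F≈0 u) (sym (zeroˡ 0#))) ⟩
    sumUpTo b (λ _ → 0# * 0#) ≈⟨ sumUpTo-* b 0# (λ _ → 0#) ⟩
    0# * _                    ≈⟨ zeroˡ _ ⟩
    0#                        ∎

  collapseˡ : ∀ b {F : Index → Index → K} → (∀ u v → deg u ≢ 0 → F u v ≈ 0#) →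
              sumUpTo b (λ u → sumUpTo b (F u)) ≈ sumUpTo b (F unit)
  collapseˡ b F≈0 = sumUpTo-unit b (λ u u≢0 → sumUpTo-0 b (λ v → F≈0 u v u≢0))

  collapseʳ : ∀ b {F : Index → Index → K} → (∀ u v → deg v ≢ 0 → F u v ≈ 0#) →
              sumUpTo b (λ u → sumUpTo b (F u)) ≈ sumUpTo b (λ u → F u unit)
  collapseʳ b F≈0 = sumUpTo-cong b (λ u _ → sumUpTo-unit b (F≈0 u))

  Δ-counitˡ-scaled : ∀ b {a} F → a ≈ 1# → sumUpTo b (λ v → Δ b unit v * (a * F v)) ≈ F b
  Δ-counitˡ-scaled b F a≈1 =
    trans (sumUpTo-cong b (λ v _ → *-congˡ (trans (*-congʳ a≈1) (*-identityˡ _)))) (Δ-counitˡ b F)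

  Δ-counitʳ-scaled : ∀ b {a} F → a ≈ 1# → sumUpTo b (λ u → Δ b u unit * (F u * a)) ≈ F b
  Δ-counitʳ-scaled b F a≈1 =
    trans (sumUpTo-cong b (λ u _ → *-congˡ (trans (*-congˡ a≈1) (*-identityʳ _)))) (Δ-counitʳ b F)

  ⋆-identityˡ : ∀ {e} → IsCounit e → ∀ f → e ⋆ f ≋ f
  ⋆-identityˡ (e-unit≈1 , e≈0) f b =
    trans (collapseˡ b (λ u v u≢0 → y≈0⇒x*y≈0 _ (x≈0⇒x*y≈0 _ (e≈0 u u≢0)))) (Δ-counitˡ-scaled b f e-unit≈1)

  ⋆-identityʳ : ∀ {e} → IsCounit e → ∀ f → f ⋆ e ≋ f
  ⋆-identityʳ (e-unit≈1 , e≈0) f b =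
    trans (collapseʳ b (λ u v v≢0 → y≈0⇒x*y≈0 _ (y≈0⇒x*y≈0 _ (e≈0 v v≢0)))) (Δ-counitʳ-scaled b f e-unit≈1)

  ⋆-unital : ∀ {f g} → Unital f → Unital g → Unital (f ⋆ g)
  ⋆-unital {f} {g} f-unital g-unital b b≡0 = begin
    (f ⋆ g) b
      ≈⟨ collapseˡ b (λ u v u≢0 → x≈0⇒x*y≈0 _ (Δ-graded b u v (u≢0 ∘ deg-u≡0 u v))) ⟩
    sumUpTo b (λ v → Δ b unit v * (f unit * g v)) ≈⟨ Δ-counitˡ-scaled b g (f-unital unit deg-unit) ⟩
    g b                                            ≈⟨ g-unital b b≡0 ⟩
    1#                                             ∎
    where
    deg-u≡0 : ∀ u v → deg u +ℕ deg v ≡ deg b → deg u ≡ 0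
    deg-u≡0 u v eq = ℕₚ.m+n≡0⇒m≡0 (deg u) (≡.trans eq b≡0)

  ⋆-additiveˡ : ∀ {f f₁ f₂} g b → (∀ u → f u ≈ f₁ u + f₂ u) → (f ⋆ g) b ≈ (f₁ ⋆ g) b + (f₂ ⋆ g) b
  ⋆-additiveˡ g b f≈f₁+f₂ = trans
    (sumUpTo-cong b (λ u _ → sumUpTo-cong b (λ v _ →
      trans (*-congˡ (trans (*-congʳ (f≈f₁+f₂ u)) (distribʳ _ _ _))) (distribˡ _ _ _))))
    (trans (sumUpTo-cong b (λ u _ → sumUpTo-+ b _ _)) (sumUpTo-+ b _ _))

  ⋆-additiveʳ : ∀ f {g g₁ g₂} b → (∀ v → g v ≈ g₁ v + g₂ v) → (f ⋆ g) b ≈ (f ⋆ g₁) b + (f ⋆ g₂) b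
  ⋆-additiveʳ f b g≈g₁+g₂ = trans
    (sumUpTo-cong b (λ u _ → sumUpTo-cong b (λ v _ →
      trans (*-congˡ (trans (*-congˡ (g≈g₁+g₂ v)) (distribˡ _ _ _))) (distribˡ _ _ _))))
    (trans (sumUpTo-cong b (λ u _ → sumUpTo-+ b _ _)) (sumUpTo-+ b _ _))

  module _ {b n} (b≡1+n : deg b ≡ suc n) where
    private
      b≰n : ¬ deg b ≤ n
      b≰n = m≡1+n⇒m≰n b≡1+n

    -- Against a unital factor, the part of f above degree n only meets Δ b in the term b ⊗ unit.
    ⇂⋆-top : ∀ f {g} → Unital g → ((f ⇂ n) ⋆ g) b ≈ f b
    ⇂⋆-top f {g} g-unital =
      trans (collapseʳ b vanish) (trans (Δ-counitʳ-scaled b (f ⇂ n) (g-unital unit deg-unit)) (⇂-≰ f b≰n))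
      where
      vanish : ∀ u v → deg v ≢ 0 → Δ b u v * ((f ⇂ n) u * g v) ≈ 0#
      vanish u v v≢0 with deg u ≤? n
      ... | yes _  = y≈0⇒x*y≈0 _ (zeroˡ _)
      ... | no u≰n = x≈0⇒x*y≈0 _ (Δ-graded b u v (λ eq → +-≢-suc (deg u) (deg v) n u≰n v≢0 (≡.trans eq b≡1+n)))

    ⋆⇂-top : ∀ {f} g → Unital f → (f ⋆ (g ⇂ n)) b ≈ g b
    ⋆⇂-top {f} g f-unital =
      trans (collapseˡ b vanish) (trans (Δ-counitˡ-scaled b (g ⇂ n) (f-unital unit deg-unit)) (⇂-≰ g b≰n))
      where
      vanish : ∀ u v → deg u ≢ 0 → Δ b u v * (f u * (g ⇂ n) v) ≈ 0#
      vanish u v u≢0 with deg v ≤? n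
      ... | yes _  = y≈0⇒x*y≈0 _ (zeroʳ _)
      ... | no v≰n = x≈0⇒x*y≈0 _ (Δ-graded b u v (λ eq → +-≢-suc (deg v) (deg u) n v≰n u≢0
                       (≡.trans (ℕₚ.+-comm (deg v) (deg u)) (≡.trans eq b≡1+n))))

    ⋆-topˡ : ∀ f {g} → Unital g → (f ⋆ g) b ≈ ((f ↾ n) ⋆ g) b + f b
    ⋆-topˡ f g-unital = trans (⋆-additiveˡ _ b (↾+⇂ f n)) (+-congˡ (⇂⋆-top f g-unital))

    ⋆-topʳ : ∀ {f} g → Unital f → (f ⋆ g) b ≈ (f ⋆ (g ↾ n)) b + g b
    ⋆-topʳ g f-unital = trans (⋆-additiveʳ _ b (↾+⇂ g n)) (+-congˡ (⋆⇂-top g f-unital))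

  ↾-⋆ : ∀ f g n → (f ⋆ g) ↾ n ≋ ((f ↾ n) ⋆ g) ↾ n
  ↾-⋆ f g n = ↾-cong n (λ b b≤n → ⋆-local b (λ u u≤b → sym (↾-≤ f (ℕₚ.≤-trans u≤b b≤n))) (λ _ _ → refl))

  module Triangular
    (T        : Functional → Functional)
    (T-cong   : ∀ {f f′} → f ≋ f′ → T f ≋ T f′)
    (T-unital : ∀ {f} → Unital f → Unital (T f))
    {γ γ⁻¹ : K} (γ⁻¹γ≈1 : γ⁻¹ * γ ≈ 1#)
    (T-top    : ∀ {f b n} → Unital f → deg b ≡ suc n → T f b ≈ T (f ↾ n) b + γ * f b)
    where

    private
      γ⁻¹γ-cancel : ∀ a → γ⁻¹ * (γ * a) ≈ a
      γ⁻¹γ-cancel a = trans (sym (*-assoc _ _ _)) (trans (*-congʳ γ⁻¹γ≈1) (*-identityˡ a))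

      γγ⁻¹-cancel : ∀ a → γ * (γ⁻¹ * a) ≈ a
      γγ⁻¹-cancel a = trans (sym (*-assoc _ _ _)) (trans (*-congʳ (trans (*-comm γ γ⁻¹) γ⁻¹γ≈1)) (*-identityˡ a))

      γ-cancel : ∀ {a b} → γ * a ≈ γ * b → a ≈ b
      γ-cancel {a} {b} γa≈γb = trans (sym (γ⁻¹γ-cancel a)) (trans (*-congˡ γa≈γb) (γ⁻¹γ-cancel b))

    injective : ∀ {f g} → Unital f → Unital g → T f ≋ T g → f ≋ g
    injective {f} {g} f-unital g-unital Tf≈Tg x = agree (deg x) x ℕₚ.≤-refl
      where
      agree : ∀ n x → deg x ≤ n → f x ≈ g x
      agree zero x x≤0 = trans (f-unital x x≡0) (sym (g-unital x x≡0))
        where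
        x≡0 : deg x ≡ 0
        x≡0 = ℕₚ.n≤0⇒n≡0 x≤0
      agree (suc n) x x≤1+n with deg x ≤? n
      ... | yes x≤n = agree n x x≤n
      ... | no x≰n  = γ-cancel (+-cancelˡ (T (f ↾ n) x) _ _ (begin
        T (f ↾ n) x + γ * f x ≈⟨ T-top f-unital x≡1+n ⟨
        T f x                 ≈⟨ Tf≈Tg x ⟩
        T g x                 ≈⟨ T-top g-unital x≡1+n ⟩
        T (g ↾ n) x + γ * g x ≈⟨ +-congʳ (T-cong (↾-cong n (agree n)) x) ⟨
        T (f ↾ n) x + γ * g x ∎))
        where
        x≡1+n : deg x ≡ suc n
        x≡1+n = m≤1+n∧m≰n⇒m≡1+n x≤1+n x≰n

    module _ {t} (t-unital : Unital t) where
      private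
        -- approx n is the solution in degrees ≤ n only; above degree n its values are junk,
        -- which is why it is only ever used truncated.
        approx : ℕ → Functional
        approx zero    u = 1#
        approx (suc n) u = ifᵈ deg u ≤? n then approx n u else γ⁻¹ * (t u - T (approx n ↾ n) u)

        solution : Functional
        solution u = approx (deg u) u

        approx-top : ∀ {n u} → deg u ≡ suc n → solution u ≈ γ⁻¹ * (t u - T (approx n ↾ n) u)
        approx-top {n} {u} u≡1+n = ≡.subst (λ m → approx m u ≈ γ⁻¹ * (t u - T (approx n ↾ n) u)) (≡.sym u≡1+n)
          (ifᵈ-no (deg u ≤? n) (m≡1+n⇒m≰n u≡1+n))

        approx-stable : ∀ n u → deg u ≤ n → approx n u ≈ solution u
        approx-stable zero    u u≤0 = ≡.subst (λ m → 1# ≈ approx m u) (≡.sym (ℕₚ.n≤0⇒n≡0 u≤0)) refl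
        approx-stable (suc n) u u≤1+n with deg u ≤? n
        ... | yes u≤n = approx-stable n u u≤n
        ... | no u≰n  = sym (approx-top (m≤1+n∧m≰n⇒m≡1+n u≤1+n u≰n))

        solution-unital : Unital solution
        solution-unital u u≡0 = sym (approx-stable 0 u (ℕₚ.≤-reflexive u≡0))

        solves : T solution ≋ t
        solves x with deg x in x≡
        ... | zero  = trans (T-unital solution-unital x x≡) (sym (t-unital x x≡))
        ... | suc n = begin
          T solution x                              ≈⟨ T-top solution-unital x≡ ⟩
          T (solution ↾ n) x + γ * solution x       ≈⟨ +-cong (T-cong (↾-cong n (λ u u≤n → sym (approx-stable n u u≤n))) x)
                                                                (*-congˡ (approx-top x≡)) ⟩
          a + γ * (γ⁻¹ * (t x - a))                 ≈⟨ +-congˡ (γγ⁻¹-cancel _) ⟩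
          a + (t x - a)                             ≈⟨ +-assoc _ _ _ ⟨
          a + t x - a                               ≈⟨ x+y-x≈y a (t x) ⟩
          t x                                       ∎
          where
          a : K
          a = T (approx n ↾ n) x

      surjective : Σ Functional (λ f → Unital f × T f ≋ t)
      surjective = solution , solution-unital , solves

  module _ {ψ} (ψ-unital : Unital ψ) where
    sandwich : Functional → Functional
    sandwich f = f ⋆ ψ ⋆ f

    sandwich-cong : ∀ {f f′} → f ≋ f′ → sandwich f ≋ sandwich f′
    sandwich-cong f≈f′ = ⋆-cong (⋆-cong f≈f′ (λ _ → refl)) f≈f′

    sandwich-unital : ∀ {f} → Unital f → Unital (sandwich f)
    sandwich-unital f-unital = ⋆-unital (⋆-unital f-unital ψ-unital) f-unital

    sandwich-top : ∀ {f b n} → Unital f → deg b ≡ suc n → sandwich f b ≈ sandwich (f ↾ n) b + (1# + 1#) * f b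
    sandwich-top {f} {b} {n} f-unital b≡1+n = begin
      (f ⋆ ψ ⋆ f) b                                   ≈⟨ ⋆-topʳ b≡1+n f (⋆-unital f-unital ψ-unital) ⟩
      (f ⋆ ψ ⋆ f↾n) b + f b                           ≈⟨ +-congʳ (⋆-topˡ b≡1+n (f ⋆ ψ) f↾n-unital) ⟩
      ((f ⋆ ψ) ↾ n ⋆ f↾n) b + (f ⋆ ψ) b + f b
        ≈⟨ +-congʳ (+-cong (⋆-cong (↾-⋆ f ψ n) (λ _ → refl) b) (⋆-topˡ b≡1+n f ψ-unital)) ⟩
      ((f↾n ⋆ ψ) ↾ n ⋆ f↾n) b + ((f↾n ⋆ ψ) b + f b) + f b
        ≈⟨ +-Solver.solve 3 (λ A B x → ((A ⊕ (B ⊕ x)) ⊕ x) ⊜ ((A ⊕ B) ⊕ (x ⊕ x))) refl _ _ (f b) ⟩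
      ((f↾n ⋆ ψ) ↾ n ⋆ f↾n) b + (f↾n ⋆ ψ) b + (f b + f b)
        ≈⟨ +-congˡ (trans (distribʳ _ _ _) (+-cong (*-identityˡ _) (*-identityˡ _))) ⟨
      ((f↾n ⋆ ψ) ↾ n ⋆ f↾n) b + (f↾n ⋆ ψ) b + (1# + 1#) * f b
        ≈⟨ +-congʳ (⋆-topˡ b≡1+n (f↾n ⋆ ψ) f↾n-unital) ⟨
      (f↾n ⋆ ψ ⋆ f↾n) b + (1# + 1#) * f b              ∎
      where
      open +-Solver using (_⊕_; _⊜_)
      f↾n : Functional
      f↾n = f ↾ n
      f↾n-unital : Unital f↾n
      f↾n-unital = ↾-unital n f-unital

    module _ {½ : K} (½·2≈1 : ½ * (1# + 1#) ≈ 1#) where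
      open Triangular sandwich sandwich-cong sandwich-unital ½·2≈1 sandwich-top public
        renaming (injective to sandwich-injective; surjective to sandwich-surjective)

  right-inverse : ∀ {f} → Unital f → ∀ {e} → Unital e → Σ Functional (λ g → Unital g × f ⋆ g ≋ e)
  right-inverse {f} f-unital = surjective
    where
    open Triangular (f ⋆_) (⋆-cong (λ _ → refl)) (⋆-unital f-unital) (*-identityˡ 1#)
      (λ {g} _ b≡1+n → trans (⋆-topʳ b≡1+n g f-unital) (+-congˡ (sym (*-identityˡ _))))

module HopfConvolution {c ℓ} (k : Field c ℓ) {dim₊ : ℕ → ℕ} (H : Over.GradedConnectedHopfAlgebra k dim₊) where
  open Scalars k
  open GradedSums k dim₊
  open Over.HopfAlgebra k H
  open import Algebra.Properties.Ring ring using (-‿involutive; -‿distribˡ-*; -‿distribʳ-*)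
  open import Relation.Binary.Reasoning.Setoid setoid

  comult-counitˡ-Σ≤ : ∀ b F → Σ≤ (deg b) (λ v → comult b one v * F v) ≈ F b
  comult-counitˡ-Σ≤ b F = trans (Σ≤-cong (deg b) (λ v _ → *-congʳ (counitˡ b v))) (Σ≤-δ (deg b) b F ℕₚ.≤-refl)

  comult-counitʳ-Σ≤ : ∀ b F → Σ≤ (deg b) (λ u → comult b u one * F u) ≈ F b
  comult-counitʳ-Σ≤ b F = trans (Σ≤-cong (deg b) (λ u _ → *-congʳ (counitʳ b u))) (Σ≤-δ (deg b) b F ℕₚ.≤-refl)

  coalgebra : GradedCoalgebra k
  coalgebra = record
    { Index        = Basis
    ; deg          = deg
    ; unit         = one
    ; deg-unit     = ≡.refl
    ; sumUpTo      = λ b → Σ≤ (deg b)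
    ; sumUpTo-cong = λ b → Σ≤-cong (deg b)
    ; sumUpTo-+    = λ b → Σ≤-+ (deg b)
    ; sumUpTo-*    = λ b → Σ≤-* (deg b)
    ; sumUpTo-unit = λ b → Σ≤-unit (deg b)
    ; Δ            = comult
    ; Δ-graded     = comult-graded
    ; Δ-counitˡ    = comult-counitˡ-Σ≤
    ; Δ-counitʳ    = comult-counitʳ-Σ≤
    }

  module C = Convolution coalgebra

  ε-counit : C.IsCounit ε
  ε-counit = refl , vanish
    where
    vanish : ∀ u → deg u ≢ 0 → ε u ≈ 0#
    vanish (zero  , _) u≢0 = contradiction ≡.refl u≢0
    vanish (suc _ , _) _   = refl

  unit-unital : ∀ {f} → f one ≈ 1# → C.Unital f
  unit-unital f-unit (zero , Fin.zero) _ = f-unit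

  restricts⇒unital : ∀ {f} → RestrictsToε f → C.Unital f
  restricts⇒unital f₀≈ε (zero , i) _ = f₀≈ε i

  unital⇒restricts : ∀ {f} → C.Unital f → RestrictsToε f
  unital⇒restricts f-unital i = f-unital (0 , i) ≡.refl

  comult-≰ˡ : ∀ b x y → ¬ deg x ≤ deg b → comult b x y ≈ 0#
  comult-≰ˡ b x y x≰b = comult-graded b x y (λ eq → x≰b (ℕₚ.≤-trans (ℕₚ.m≤m+n (deg x) (deg y)) (ℕₚ.≤-reflexive eq)))

  comult-≰ʳ : ∀ b x y → ¬ deg y ≤ deg b → comult b x y ≈ 0#
  comult-≰ʳ b x y y≰b = comult-graded b x y (λ eq → y≰b (ℕₚ.≤-trans (ℕₚ.m≤n+m (deg y) (deg x)) (ℕₚ.≤-reflexive eq)))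

  ⋆-as-Σ≤ : ∀ f g {u n} → deg u ≤ n → (f ⋆ g) u ≈ Σ≤ n (λ x → Σ≤ n (λ y → comult u x y * (f x * g y)))
  ⋆-as-Σ≤ f g {u} {n} u≤n = trans
    (Σ≤-cong (deg u) (λ x _ → Σ≤-extend (deg u) n u≤n (λ y y≰u → x≈0⇒x*y≈0 _ (comult-≰ʳ u x y y≰u))))
    (Σ≤-extend (deg u) n u≤n (λ x x≰u → Σ≤-0 n (λ y _ → x≈0⇒x*y≈0 _ (comult-≰ˡ u x y x≰u))))

  comult-coassoc-Σ≤ : ∀ b x y z →
    Σ≤ (deg b) (λ c → comult b c z * comult c x y) ≈ Σ≤ (deg b) (λ c → comult b x c * comult c y z)
  comult-coassoc-Σ≤ b x y z = begin
    Σ≤ (deg b) L                  ≈⟨ Σ≤-graded (deg b) _ (λ c c≢ → y≈0⇒x*y≈0 _ (comult-graded c x y (c≢ ∘ ≡.sym)))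
                                                          (λ c c≰b → x≈0⇒x*y≈0 _ (comult-≰ˡ b c z c≰b)) ⟩
    Σdeg (deg x +ℕ deg y) L       ≈⟨ comult-coassoc b x y z ⟩
    Σdeg (deg y +ℕ deg z) R       ≈⟨ Σ≤-graded (deg b) _ (λ c c≢ → y≈0⇒x*y≈0 _ (comult-graded c y z (c≢ ∘ ≡.sym)))
                                                          (λ c c≰b → x≈0⇒x*y≈0 _ (comult-≰ʳ b x c c≰b)) ⟨
    Σ≤ (deg b) R                  ∎
    where
    L R : Basis → K
    L c = comult b c z * comult c x y
    R c = comult b x c * comult c y z

  ⋆-assoc : ∀ f g h → ((f ⋆ g) ⋆ h) ≋ (f ⋆ (g ⋆ h))
  ⋆-assoc f g h b = trans expandˡ (sym expandʳ)
    where
    open *-Solver using (solve; _⊕_; _⊜_)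
    n : ℕ
    n = deg b
    ∑ : (Basis → K) → K
    ∑ = Σ≤ n
    ∑-cong : ∀ {F G : Basis → K} → (∀ x → F x ≈ G x) → ∑ F ≈ ∑ G
    ∑-cong F≈G = Σ≤-cong n (λ x _ → F≈G x)
    ∑-swap : ∀ (F : Basis → Basis → K) → ∑ (λ x → ∑ (F x)) ≈ ∑ (λ y → ∑ (λ x → F x y))
    ∑-swap = Σ≤-swap n n
    W : Basis → Basis → Basis → K
    W x y z = f x * (g y * h z)

    expandˡ : ((f ⋆ g) ⋆ h) b ≈ ∑ λ x → ∑ λ y → ∑ λ z → ∑ (λ c → comult b x c * comult c y z) * W x y z
    expandˡ = begin
      ((f ⋆ g) ⋆ h) b
        ≈⟨ Σ≤-cong n (λ c c≤n → ∑-cong (λ z → *-congˡ (*-congʳ (⋆-as-Σ≤ f g c≤n)))) ⟩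
      (∑ λ c → ∑ λ z → comult b c z * ((∑ λ x → ∑ λ y → comult c x y * (f x * g y)) * h z))
        ≈⟨ ∑-cong (λ c → ∑-cong (λ z → trans (Σ≤-*-*ʳ n _ _ _) (∑-cong (λ x → trans (Σ≤-*-*ʳ n _ _ _) (∑-cong (λ y →
             solve 5 (λ a d p q r → (a ⊕ ((d ⊕ (p ⊕ q)) ⊕ r)) ⊜ ((a ⊕ d) ⊕ (p ⊕ (q ⊕ r)))) refl
               (comult b c z) (comult c x y) (f x) (g y) (h z))))))) ⟩
      (∑ λ c → ∑ λ z → ∑ λ x → ∑ λ y → (comult b c z * comult c x y) * W x y z)
        ≈⟨ ∑-cong (λ c → trans (∑-swap _) (∑-cong (λ x → ∑-swap _))) ⟩
      (∑ λ c → ∑ λ x → ∑ λ y → ∑ λ z → (comult b c z * comult c x y) * W x y z)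
        ≈⟨ trans (∑-swap _) (∑-cong (λ x → trans (∑-swap _) (∑-cong (λ y → ∑-swap _)))) ⟩
      (∑ λ x → ∑ λ y → ∑ λ z → ∑ λ c → (comult b c z * comult c x y) * W x y z)
        ≈⟨ ∑-cong (λ x → ∑-cong (λ y → ∑-cong (λ z → trans (Σ≤-*ʳ n _ _) (*-congʳ (comult-coassoc-Σ≤ b x y z))))) ⟩
      (∑ λ x → ∑ λ y → ∑ λ z → ∑ (λ c → comult b x c * comult c y z) * W x y z)
        ∎

    expandʳ : (f ⋆ (g ⋆ h)) b ≈ ∑ λ x → ∑ λ y → ∑ λ z → ∑ (λ c → comult b x c * comult c y z) * W x y z
    expandʳ = begin
      (f ⋆ (g ⋆ h)) b
        ≈⟨ ∑-cong (λ x → Σ≤-cong n (λ c c≤n → *-congˡ (*-congˡ (⋆-as-Σ≤ g h c≤n)))) ⟩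
      (∑ λ x → ∑ λ c → comult b x c * (f x * (∑ λ y → ∑ λ z → comult c y z * (g y * h z))))
        ≈⟨ ∑-cong (λ x → ∑-cong (λ c → trans (Σ≤-*-*ˡ n _ _ _) (∑-cong (λ y → trans (Σ≤-*-*ˡ n _ _ _) (∑-cong (λ z →
             solve 5 (λ a p d q r → (a ⊕ (p ⊕ (d ⊕ (q ⊕ r)))) ⊜ ((a ⊕ d) ⊕ (p ⊕ (q ⊕ r)))) refl
               (comult b x c) (f x) (comult c y z) (g y) (h z))))))) ⟩
      (∑ λ x → ∑ λ c → ∑ λ y → ∑ λ z → (comult b x c * comult c y z) * W x y z)
        ≈⟨ ∑-cong (λ x → trans (∑-swap _) (∑-cong (λ y → ∑-swap _))) ⟩
      (∑ λ x → ∑ λ y → ∑ λ z → ∑ λ c → (comult b x c * comult c y z) * W x y z)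
        ≈⟨ ∑-cong (λ x → ∑-cong (λ y → ∑-cong (λ z → Σ≤-*ʳ n _ _))) ⟩
      (∑ λ x → ∑ λ y → ∑ λ z → ∑ (λ c → comult b x c * comult c y z) * W x y z)
        ∎

  convolutionMonoid : Monoid c ℓ
  convolutionMonoid = record
    { Carrier  = Functional
    ; _≈_      = _≋_
    ; _∙_      = _⋆_
    ; ε        = ε
    ; isMonoid = record
      { isSemigroup = record
        { isMagma = record { isEquivalence = Setoid.isEquivalence C.≋-setoid ; ∙-cong = C.⋆-cong }
        ; assoc   = ⋆-assoc
        }
      ; identity = C.⋆-identityˡ ε-counit , C.⋆-identityʳ ε-counit
      }
    }

  module M  = Monoid convolutionMonoid
  module MP = Algebra.Properties.Monoid convolutionMonoid

  left-inverse≋right-inverse : ∀ {x y z} → (x ⋆ y) ≋ ε → (y ⋆ z) ≋ ε → x ≋ z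
  left-inverse≋right-inverse {x} {y} {z} xy≋ε yz≋ε = M.trans (M.sym (MP.cancelʳ yz≋ε x)) (MP.elimˡ xy≋ε z)

  ε-unital : C.Unital ε
  ε-unital = unit-unital {ε} refl

  unital-invertible : ∀ {σ} → C.Unital σ → Σ Functional (λ σ⁻¹ → C.Unital σ⁻¹ × IsInverse σ σ⁻¹)
  unital-invertible σ-unital with C.right-inverse σ-unital ε-unital
  ... | σ⁻¹ , σ⁻¹-unital , σσ⁻¹≋ε with C.right-inverse σ⁻¹-unital ε-unital
  ...   | _ , _ , σ⁻¹σ′≋ε =
    σ⁻¹ , σ⁻¹-unital , σσ⁻¹≋ε , M.trans (M.∙-congˡ (left-inverse≋right-inverse σσ⁻¹≋ε σ⁻¹σ′≋ε)) σ⁻¹σ′≋ε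

  sign-cong : ∀ n {a b} → a ≈ b → sign n a ≈ sign n b
  sign-cong zero    a≈b = a≈b
  sign-cong (suc n) a≈b = -‿cong (sign-cong n a≈b)

  sign-‿ : ∀ n a → sign n (- a) ≈ - sign n a
  sign-‿ zero    a = refl
  sign-‿ (suc n) a = -‿cong (sign-‿ n a)

  sign-involutive : ∀ n a → sign n (sign n a) ≈ a
  sign-involutive zero    a = refl
  sign-involutive (suc n) a = trans (-‿cong (sign-‿ n _)) (trans (-‿involutive _) (sign-involutive n a))

  sign-*ˡ : ∀ n a b → sign n (a * b) ≈ a * sign n b
  sign-*ˡ zero    a b = refl
  sign-*ˡ (suc n) a b = trans (-‿cong (sign-*ˡ n a b)) (-‿distribʳ-* a _)

  sign-*ʳ : ∀ n a b → sign n (a * b) ≈ sign n a * b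
  sign-*ʳ zero    a b = refl
  sign-*ʳ (suc n) a b = trans (-‿cong (sign-*ʳ n a b)) (-‿distribˡ-* _ b)

  sign-+ : ∀ m n a → sign m (sign n a) ≡ sign (m +ℕ n) a
  sign-+ zero    n a = ≡.refl
  sign-+ (suc m) n a = ≡.cong -_ (sign-+ m n a)

  sign-* : ∀ m n a b → sign m a * sign n b ≈ sign (m +ℕ n) (a * b)
  sign-* m n a b = begin
    sign m a * sign n b     ≈⟨ sign-*ʳ m a _ ⟨
    sign m (a * sign n b)   ≈⟨ sign-cong m (sign-*ˡ n a b) ⟨
    sign m (sign n (a * b)) ≡⟨ sign-+ m n (a * b) ⟩
    sign (m +ℕ n) (a * b)   ∎

  sign-0 : ∀ n → sign n 0# ≈ 0#
  sign-0 n = trans (sign-cong n (sym (zeroˡ 0#))) (trans (sign-*ˡ n 0# 0#) (zeroˡ _))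

  sign-scale : ∀ n a → sign n a ≈ a * sign n 1#
  sign-scale n a = trans (sign-cong n (sym (*-identityʳ a))) (sign-*ˡ n a 1#)

  sign-Σ≤ : ∀ n m F → sign n (Σ≤ m F) ≈ Σ≤ m (λ x → sign n (F x))
  sign-Σ≤ n m F = begin
    sign n (Σ≤ m F)              ≈⟨ sign-scale n _ ⟩
    Σ≤ m F * sign n 1#           ≈⟨ Σ≤-*ʳ m F _ ⟨
    Σ≤ m (λ x → F x * sign n 1#) ≈⟨ Σ≤-cong m (λ x _ → sym (sign-scale n (F x))) ⟩
    Σ≤ m (λ x → sign n (F x))    ∎

  comult-supported : ∀ b u v → deg u +ℕ deg v ≡ deg b ⊎ comult b u v ≈ 0#
  comult-supported b u v with deg u +ℕ deg v ℕ.≟ deg b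
  ... | yes u+v≡b = inj₁ u+v≡b
  ... | no u+v≢b  = inj₂ (comult-graded b u v u+v≢b)

  bar-cong : ∀ {f g} → f ≋ g → bar f ≋ bar g
  bar-cong f≋g b = sign-cong (deg b) (f≋g b)

  bar-involutive : ∀ f → bar (bar f) ≋ f
  bar-involutive f b = sign-involutive (deg b) (f b)

  bar-ε : bar ε ≋ ε
  bar-ε (zero  , _) = refl
  bar-ε (suc m , _) = sign-0 (suc m)

  bar-unital : ∀ {f} → C.Unital f → C.Unital (bar f)
  bar-unital f-unital (zero , i) = f-unital (zero , i)

  bar-⋆ : ∀ f g → bar (f ⋆ g) ≋ (bar f ⋆ bar g)
  bar-⋆ f g b = begin
    sign n (Σ≤ n λ u → Σ≤ n λ v → comult b u v * (f u * g v))
      ≈⟨ trans (sign-Σ≤ n n _) (Σ≤-cong n (λ u _ → sign-Σ≤ n n _)) ⟩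
    (Σ≤ n λ u → Σ≤ n λ v → sign n (comult b u v * (f u * g v)))
      ≈⟨ Σ≤-cong n (λ u _ → Σ≤-cong n (λ v _ → term u v)) ⟩
    (Σ≤ n λ u → Σ≤ n λ v → comult b u v * (bar f u * bar g v))
      ∎
    where
    n : ℕ
    n = deg b
    term : ∀ u v → sign n (comult b u v * (f u * g v)) ≈ comult b u v * (bar f u * bar g v)
    term u v with comult-supported b u v
    ... | inj₁ u+v≡b = begin
      sign n (comult b u v * (f u * g v))               ≈⟨ sign-*ˡ n _ _ ⟩
      comult b u v * sign n (f u * g v)                 ≡⟨ ≡.cong (λ m → comult b u v * sign m (f u * g v)) u+v≡b ⟨
      comult b u v * sign (deg u +ℕ deg v) (f u * g v)  ≈⟨ *-congˡ (sign-* (deg u) (deg v) _ _) ⟨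
      comult b u v * (bar f u * bar g v)                ∎
    ... | inj₂ Δ≈0 = trans (sign-cong n (x≈0⇒x*y≈0 _ Δ≈0)) (trans (sign-0 n) (sym (x≈0⇒x*y≈0 _ Δ≈0)))

module SandwichParity {c ℓ} (k : Field c ℓ) {dim₊ : ℕ → ℕ} (H : Over.GradedConnectedHopfAlgebra k dim₊) where
  open Over.HopfAlgebra k H
  open HopfConvolution k H
  open import Relation.Binary.Reasoning.Setoid C.≋-setoid

  module _ {φ ψ ρ} (ρ-unital : C.Unital ρ) (φ≋ρψρ : φ ≋ ((ρ ⋆ ψ) ⋆ ρ))
           (unique : ∀ {ρ′} → C.Unital ρ′ → φ ≋ ((ρ′ ⋆ ψ) ⋆ ρ′) → ρ′ ≋ ρ) where
    private
      σ : Functional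
      σ = bar ρ

      σ-unital : C.Unital σ
      σ-unital = bar-unital ρ-unital

      σ-inverse : Σ Functional (λ σ⁻¹ → C.Unital σ⁻¹ × IsInverse σ σ⁻¹)
      σ-inverse = unital-invertible σ-unital

      σ⁻¹ : Functional
      σ⁻¹ = proj₁ σ-inverse

      σ⁻¹-unital : C.Unital σ⁻¹
      σ⁻¹-unital = proj₁ (proj₂ σ-inverse)

      σσ⁻¹≋ε : (σ ⋆ σ⁻¹) ≋ ε
      σσ⁻¹≋ε = proj₁ (proj₂ (proj₂ σ-inverse))

      σ⁻¹σ≋ε : (σ⁻¹ ⋆ σ) ≋ ε
      σ⁻¹σ≋ε = proj₂ (proj₂ (proj₂ σ-inverse))

      bar-φ : bar φ ≋ ((σ ⋆ bar ψ) ⋆ σ)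
      bar-φ = begin
        bar φ                       ≈⟨ bar-cong φ≋ρψρ ⟩
        bar ((ρ ⋆ ψ) ⋆ ρ)           ≈⟨ bar-⋆ _ _ ⟩
        (bar (ρ ⋆ ψ) ⋆ σ)           ≈⟨ M.∙-congʳ (bar-⋆ _ _) ⟩
        ((σ ⋆ bar ψ) ⋆ σ)           ∎

    sandwich-even : (ψ ⋆ bar φ) ≋ ε → IsEven ρ
    sandwich-even ψφ̄≋ε = unique σ-unital (M.sym σψσ≋φ)
      where
      ψ̄φ≋ε : (bar ψ ⋆ φ) ≋ ε
      ψ̄φ≋ε = begin
        (bar ψ ⋆ φ)             ≈⟨ M.∙-congˡ (bar-involutive φ) ⟨
        (bar ψ ⋆ bar (bar φ))   ≈⟨ bar-⋆ _ _ ⟨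
        bar (ψ ⋆ bar φ)         ≈⟨ bar-cong ψφ̄≋ε ⟩
        bar ε                   ≈⟨ bar-ε ⟩
        ε                       ∎
      σψ̄≋φ̄σ⁻¹ : (σ ⋆ bar ψ) ≋ (bar φ ⋆ σ⁻¹)
      σψ̄≋φ̄σ⁻¹ = M.sym (M.trans (M.∙-congʳ bar-φ) (MP.cancelʳ σσ⁻¹≋ε _))
      σψσ≋φ : ((σ ⋆ ψ) ⋆ σ) ≋ φ
      σψσ≋φ = left-inverse≋right-inverse (begin
        (((σ ⋆ ψ) ⋆ σ) ⋆ bar ψ)  ≈⟨ M.assoc _ _ _ ⟩
        ((σ ⋆ ψ) ⋆ (σ ⋆ bar ψ))  ≈⟨ M.∙-congˡ σψ̄≋φ̄σ⁻¹ ⟩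
        ((σ ⋆ ψ) ⋆ (bar φ ⋆ σ⁻¹)) ≈⟨ MP.cancelᶜ ψφ̄≋ε σ σ⁻¹ ⟩
        (σ ⋆ σ⁻¹)                ≈⟨ σσ⁻¹≋ε ⟩
        ε                        ∎) ψ̄φ≋ε

    sandwich-odd : (bar φ ≋ ψ) → IsOdd ρ
    sandwich-odd φ̄≋ψ = M.trans (M.∙-congʳ (M.sym σ⁻¹≋ρ)) σ⁻¹σ≋ε , M.trans (M.∙-congˡ (M.sym σ⁻¹≋ρ)) σσ⁻¹≋ε
      where
      ψ≋σφσ : ψ ≋ ((σ ⋆ φ) ⋆ σ)
      ψ≋σφσ = begin
        ψ                     ≈⟨ φ̄≋ψ ⟨
        bar φ                 ≈⟨ bar-φ ⟩
        ((σ ⋆ bar ψ) ⋆ σ)     ≈⟨ M.∙-congʳ (M.∙-congˡ (M.trans (bar-cong (M.sym φ̄≋ψ)) (bar-involutive φ))) ⟩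
        ((σ ⋆ φ) ⋆ σ)         ∎
      σ⁻¹ψσ⁻¹≋φ : ((σ⁻¹ ⋆ ψ) ⋆ σ⁻¹) ≋ φ
      σ⁻¹ψσ⁻¹≋φ = begin
        ((σ⁻¹ ⋆ ψ) ⋆ σ⁻¹)               ≈⟨ M.∙-congʳ (M.∙-congˡ ψ≋σφσ) ⟩
        ((σ⁻¹ ⋆ ((σ ⋆ φ) ⋆ σ)) ⋆ σ⁻¹)   ≈⟨ M.∙-congʳ (M.∙-congˡ (M.assoc _ _ _)) ⟩
        ((σ⁻¹ ⋆ (σ ⋆ (φ ⋆ σ))) ⋆ σ⁻¹)   ≈⟨ M.∙-congʳ (MP.cancelˡ σ⁻¹σ≋ε _) ⟩
        ((φ ⋆ σ) ⋆ σ⁻¹)                 ≈⟨ MP.cancelʳ σσ⁻¹≋ε φ ⟩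
        φ                               ∎
      σ⁻¹≋ρ : σ⁻¹ ≋ ρ
      σ⁻¹≋ρ = unique σ⁻¹-unital (M.sym σ⁻¹ψσ⁻¹≋φ)

module TensorSquare {c ℓ} (k : Field c ℓ) {dim₊ : ℕ → ℕ} (H : Over.GradedConnectedHopfAlgebra k dim₊) where
  open Scalars k
  open FiniteSums k
  open GradedSums k dim₊
  open Over.HopfAlgebra k H
  open HopfConvolution k H
  open import Algebra.Properties.CommutativeSemigroup ℕₚ.+-commutativeSemigroup
    using () renaming (interchange to +ℕ-interchange)
  open import Relation.Binary.Reasoning.Setoid setoid

  Basis² : Set
  Basis² = Basis × Basis

  deg² : Basis² → ℕ
  deg² (x , y) = deg x +ℕ deg y

  Σ≤² : Basis² → (Basis² → K) → K
  Σ≤² (x , y) F = Σ≤ (deg x) (λ x₁ → Σ≤ (deg y) (λ y₁ → F (x₁ , y₁)))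

  comult² : Basis² → Basis² → Basis² → K
  comult² (x , y) (x₁ , y₁) (x₂ , y₂) = comult x x₁ x₂ * comult y y₁ y₂

  Σ≤²-cong : ∀ b {F G} → (∀ u → deg² u ≤ deg² b → F u ≈ G u) → Σ≤² b F ≈ Σ≤² b G
  Σ≤²-cong (x , y) F≈G =
    Σ≤-cong (deg x) (λ x₁ x₁≤x → Σ≤-cong (deg y) (λ y₁ y₁≤y → F≈G (x₁ , y₁) (ℕₚ.+-mono-≤ x₁≤x y₁≤y)))

  Σ≤²-unit : ∀ b {F} → (∀ u → deg² u ≢ 0 → F u ≈ 0#) → Σ≤² b F ≈ F (one , one)
  Σ≤²-unit (x , y) F≈0 = trans
    (Σ≤-unit (deg x) (λ x₁ x₁≢0 → Σ≤-0 (deg y) (λ y₁ _ → F≈0 (x₁ , y₁) (x₁≢0 ∘ ℕₚ.m+n≡0⇒m≡0 (deg x₁)))))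
    (Σ≤-unit (deg y) (λ y₁ y₁≢0 → F≈0 (one , y₁) y₁≢0))

  comult²-graded : ∀ b u v → deg² u +ℕ deg² v ≢ deg² b → comult² b u v ≈ 0#
  comult²-graded (x , y) (x₁ , y₁) (x₂ , y₂) u+v≢b with comult-supported x x₁ x₂ | comult-supported y y₁ y₂
  ... | inj₂ Δx≈0 | _         = x≈0⇒x*y≈0 _ Δx≈0
  ... | inj₁ _    | inj₂ Δy≈0 = y≈0⇒x*y≈0 _ Δy≈0
  ... | inj₁ x₁₂≡x | inj₁ y₁₂≡y =
    contradiction (≡.trans (+ℕ-interchange (deg x₁) (deg y₁) (deg x₂) (deg y₂)) (≡.cong₂ _+ℕ_ x₁₂≡x y₁₂≡y)) u+v≢b

  comult²-counitˡ : ∀ b (F : Basis² → K) → Σ≤² b (λ v → comult² b (one , one) v * F v) ≈ F b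
  comult²-counitˡ (x , y) F = begin
    (Σ≤ (deg x) λ x₁ → Σ≤ (deg y) λ y₁ → comult x one x₁ * comult y one y₁ * F (x₁ , y₁))
      ≈⟨ Σ≤-cong (deg x) (λ x₁ _ → trans (Σ≤-cong (deg y) (λ y₁ _ → *-assoc _ _ _)) (Σ≤-* (deg y) _ _)) ⟩
    (Σ≤ (deg x) λ x₁ → comult x one x₁ * Σ≤ (deg y) λ y₁ → comult y one y₁ * F (x₁ , y₁))
      ≈⟨ Σ≤-cong (deg x) (λ x₁ _ → *-congˡ (comult-counitˡ-Σ≤ y (λ y₁ → F (x₁ , y₁)))) ⟩
    (Σ≤ (deg x) λ x₁ → comult x one x₁ * F (x₁ , y))
      ≈⟨ comult-counitˡ-Σ≤ x (λ x₁ → F (x₁ , y)) ⟩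
    F (x , y) ∎

  comult²-counitʳ : ∀ b (F : Basis² → K) → Σ≤² b (λ u → comult² b u (one , one) * F u) ≈ F b
  comult²-counitʳ (x , y) F = begin
    (Σ≤ (deg x) λ x₁ → Σ≤ (deg y) λ y₁ → comult x x₁ one * comult y y₁ one * F (x₁ , y₁))
      ≈⟨ Σ≤-cong (deg x) (λ x₁ _ → trans (Σ≤-cong (deg y) (λ y₁ _ → *-assoc _ _ _)) (Σ≤-* (deg y) _ _)) ⟩
    (Σ≤ (deg x) λ x₁ → comult x x₁ one * Σ≤ (deg y) λ y₁ → comult y y₁ one * F (x₁ , y₁))
      ≈⟨ Σ≤-cong (deg x) (λ x₁ _ → *-congˡ (comult-counitʳ-Σ≤ y (λ y₁ → F (x₁ , y₁)))) ⟩
    (Σ≤ (deg x) λ x₁ → comult x x₁ one * F (x₁ , y))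
      ≈⟨ comult-counitʳ-Σ≤ x (λ x₁ → F (x₁ , y)) ⟩
    F (x , y) ∎

  coalgebra² : GradedCoalgebra k
  coalgebra² = record
    { Index        = Basis²
    ; deg          = deg²
    ; unit         = one , one
    ; deg-unit     = ≡.refl
    ; sumUpTo      = Σ≤²
    ; sumUpTo-cong = Σ≤²-cong
    ; sumUpTo-+    = λ (x , y) → apply-+ (Σ≤≤-linear (deg x) (deg y))
    ; sumUpTo-*    = λ (x , y) → apply-* (Σ≤≤-linear (deg x) (deg y))
    ; sumUpTo-unit = Σ≤²-unit
    ; Δ            = comult²
    ; Δ-graded     = comult²-graded
    ; Δ-counitˡ    = comult²-counitˡ
    ; Δ-counitʳ    = comult²-counitʳ
    }

  module C² = Convolution coalgebra²

  infixl 7 _⊗_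
  _⊗_ : Functional → Functional → C².Functional
  (f ⊗ g) (x , y) = f x * g y

  _∘mult : Functional → C².Functional
  (f ∘mult) (x , y) = Σdeg (deg x +ℕ deg y) (λ c → mult x y c * f c)

  ⊗-⋆ : ∀ f f′ g g′ → ((f ⊗ f′) C².⋆ (g ⊗ g′)) C².≋ ((f ⋆ g) ⊗ (f′ ⋆ g′))
  ⊗-⋆ f f′ g g′ (x , y) = begin
    (Σ≤ dx λ x₁ → Σ≤ dy λ y₁ → Σ≤ dx λ x₂ → Σ≤ dy λ y₂ →
      comult x x₁ x₂ * comult y y₁ y₂ * (f x₁ * f′ y₁ * (g x₂ * g′ y₂)))
      ≈⟨ Σ≤-cong dx (λ x₁ _ → Σ≤-swap dy dx _) ⟩
    (Σ≤ dx λ x₁ → Σ≤ dx λ x₂ → Σ≤ dy λ y₁ → Σ≤ dy λ y₂ →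
      comult x x₁ x₂ * comult y y₁ y₂ * (f x₁ * f′ y₁ * (g x₂ * g′ y₂)))
      ≈⟨ Σ≤-cong dx (λ x₁ _ → Σ≤-cong dx (λ x₂ _ → Σ≤-cong dy (λ y₁ _ → Σ≤-cong dy (λ y₂ _ →
           solve 6 (λ a b p q r s → ((a ⊕ b) ⊕ ((p ⊕ q) ⊕ (r ⊕ s))) ⊜ ((a ⊕ (p ⊕ r)) ⊕ (b ⊕ (q ⊕ s)))) refl
             (comult x x₁ x₂) (comult y y₁ y₂) (f x₁) (f′ y₁) (g x₂) (g′ y₂))))) ⟩
    (Σ≤ dx λ x₁ → Σ≤ dx λ x₂ → Σ≤ dy λ y₁ → Σ≤ dy λ y₂ →
      comult x x₁ x₂ * (f x₁ * g x₂) * (comult y y₁ y₂ * (f′ y₁ * g′ y₂)))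
      ≈⟨ apply-product (Σ≤≤-linear dx dx) (Σ≤≤-linear dy dy) _ _ ⟩
    (f ⋆ g) x * (f′ ⋆ g′) y ∎
    where
    open *-Solver using (solve; _⊕_; _⊜_)
    dx dy : ℕ
    dx = deg x
    dy = deg y

  mult-Σ≤ : ∀ x y f {N} → deg x +ℕ deg y ≤ N → Σ≤ N (λ u → mult x y u * f u) ≈ (f ∘mult) (x , y)
  mult-Σ≤ x y f x+y≤N = Σ≤-concentrated _ _ x+y≤N (λ u u≢x+y → x≈0⇒x*y≈0 _ (mult-graded x y u u≢x+y))

  ∘mult-⋆ : ∀ f g → ((f ∘mult) C².⋆ (g ∘mult)) C².≋ ((f ⋆ g) ∘mult)
  ∘mult-⋆ f g (x , y) = sym (begin
    Σdeg N (λ c → mult x y c * (Σ≤ N λ u → Σ≤ N λ v → comult c u v * (f u * g v)))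
      ≈⟨ Σdeg-cong N (λ c _ → trans (sym (Σ≤-* N (mult x y c) (λ u → Σ≤ N λ v → comult c u v * (f u * g v))))
           (Σ≤-cong N (λ u _ → trans (sym (Σ≤-* N (mult x y c) (λ v → comult c u v * (f u * g v))))
             (Σ≤-cong N (λ v _ → sym (*-assoc (mult x y c) (comult c u v) (f u * g v))))))) ⟩
    Σdeg N (λ c → Σ≤ N λ u → Σ≤ N λ v → mult x y c * comult c u v * (f u * g v))
      ≈⟨ trans (apply-Σ≤ (Σdeg-linear N) N (λ c u → Σ≤ N λ v → T c u v))
               (Σ≤-cong N (λ u _ → apply-Σ≤ (Σdeg-linear N) N (λ c v → T c u v))) ⟩
    (Σ≤ N λ u → Σ≤ N λ v → Σdeg N (λ c → mult x y c * comult c u v * (f u * g v)))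
      ≈⟨ Σ≤-cong N (λ u _ → Σ≤-cong N (λ v _ →
           trans (apply-*ʳ (Σdeg-linear N) (λ c → mult x y c * comult c u v) (f u * g v))
                 (*-congʳ (comult-mult x y u v)))) ⟩
    (Σ≤ N λ u → Σ≤ N λ v → Σ⁴ (λ x₁ x₂ y₁ y₂ → D x₁ x₂ y₁ y₂ * (mult x₁ y₁ u * mult x₂ y₂ v)) * (f u * g v))
      ≈⟨ Σ≤-cong N (λ u _ → Σ≤-cong N (λ v _ →
           Σ⁴-*ʳ (λ x₁ x₂ y₁ y₂ → D x₁ x₂ y₁ y₂ * (mult x₁ y₁ u * mult x₂ y₂ v)) (f u * g v))) ⟩
    (Σ≤ N λ u → Σ≤ N λ v → Σ⁴ (λ x₁ x₂ y₁ y₂ → D x₁ x₂ y₁ y₂ * (mult x₁ y₁ u * mult x₂ y₂ v) * (f u * g v)))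
      ≈⟨ apply-Σ⁴ (Σ≤≤-linear N N) E ⟩
    Σ⁴ (λ x₁ x₂ y₁ y₂ → Σ≤ N λ u → Σ≤ N λ v → D x₁ x₂ y₁ y₂ * (mult x₁ y₁ u * mult x₂ y₂ v) * (f u * g v))
      ≈⟨ Σ≤-cong dx (λ x₁ _ → Σ≤-cong dx (λ x₂ _ → Σ≤-cong dy (λ y₁ _ → Σ≤-cong dy (λ y₂ _ → factor x₁ x₂ y₁ y₂)))) ⟩
    Σ⁴ (λ x₁ x₂ y₁ y₂ → D x₁ x₂ y₁ y₂ * ((f ∘mult) (x₁ , y₁) * (g ∘mult) (x₂ , y₂)))
      ≈⟨ Σ≤-cong dx (λ x₁ _ → Σ≤-swap dx dy _) ⟩
    ((f ∘mult) C².⋆ (g ∘mult)) (x , y) ∎)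
    where
    dx dy N : ℕ
    dx = deg x
    dy = deg y
    N  = dx +ℕ dy
    D : Basis → Basis → Basis → Basis → K
    D x₁ x₂ y₁ y₂ = comult x x₁ x₂ * comult y y₁ y₂
    T : Basis → Basis → Basis → K
    T c u v = mult x y c * comult c u v * (f u * g v)
    E : Basis × Basis → Basis → Basis → Basis → Basis → K
    E (u , v) x₁ x₂ y₁ y₂ = D x₁ x₂ y₁ y₂ * (mult x₁ y₁ u * mult x₂ y₂ v) * (f u * g v)
    Σ⁴ : (Basis → Basis → Basis → Basis → K) → K
    Σ⁴ F = Σ≤ dx λ x₁ → Σ≤ dx λ x₂ → Σ≤ dy λ y₁ → Σ≤ dy λ y₂ → F x₁ x₂ y₁ y₂

    Σ⁴-*ʳ : ∀ (F : Basis → Basis → Basis → Basis → K) a → Σ⁴ F * a ≈ Σ⁴ (λ x₁ x₂ y₁ y₂ → F x₁ x₂ y₁ y₂ * a)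
    Σ⁴-*ʳ F a = sym (trans (Σ≤-cong dx (λ x₁ _ → trans (Σ≤-cong dx (λ x₂ _ →
      trans (Σ≤-cong dy (λ y₁ _ → Σ≤-*ʳ dy _ a)) (Σ≤-*ʳ dy _ a))) (Σ≤-*ʳ dx _ a))) (Σ≤-*ʳ dx _ a))

    apply-Σ⁴ : ∀ {a} {A : Set a} (L : LinearForm A) (F : A → Basis → Basis → Basis → Basis → K) →
      apply L (λ p → Σ⁴ (F p)) ≈ Σ⁴ (λ x₁ x₂ y₁ y₂ → apply L (λ p → F p x₁ x₂ y₁ y₂))
    apply-Σ⁴ L F =
      trans (apply-Σ≤ L dx (λ p x₁ → Σ≤ dx λ x₂ → Σ≤ dy λ y₁ → Σ≤ dy λ y₂ → F p x₁ x₂ y₁ y₂)) (Σ≤-cong dx (λ x₁ _ →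
      trans (apply-Σ≤ L dx (λ p x₂ → Σ≤ dy λ y₁ → Σ≤ dy λ y₂ → F p x₁ x₂ y₁ y₂)) (Σ≤-cong dx (λ x₂ _ →
      trans (apply-Σ≤ L dy (λ p y₁ → Σ≤ dy λ y₂ → F p x₁ x₂ y₁ y₂)) (Σ≤-cong dy (λ y₁ _ →
      apply-Σ≤ L dy (λ p y₂ → F p x₁ x₂ y₁ y₂)))))))

    factor : ∀ x₁ x₂ y₁ y₂ →
      (Σ≤ N λ u → Σ≤ N λ v → D x₁ x₂ y₁ y₂ * (mult x₁ y₁ u * mult x₂ y₂ v) * (f u * g v))
        ≈ D x₁ x₂ y₁ y₂ * ((f ∘mult) (x₁ , y₁) * (g ∘mult) (x₂ , y₂))
    factor x₁ x₂ y₁ y₂ = begin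
      (Σ≤ N λ u → Σ≤ N λ v → d * (mult x₁ y₁ u * mult x₂ y₂ v) * (f u * g v))
        ≈⟨ Σ≤-cong N (λ u _ → Σ≤-cong N (λ v _ →
             solve 5 (λ d p q r s → ((d ⊕ (p ⊕ q)) ⊕ (r ⊕ s)) ⊜ (d ⊕ ((p ⊕ r) ⊕ (q ⊕ s))))
             refl d (mult x₁ y₁ u) (mult x₂ y₂ v) (f u) (g v))) ⟩
      (Σ≤ N λ u → Σ≤ N λ v → d * (mult x₁ y₁ u * f u * (mult x₂ y₂ v * g v)))
        ≈⟨ trans (Σ≤-cong N (λ u _ → Σ≤-* N d _)) (Σ≤-* N d _) ⟩
      d * (Σ≤ N λ u → Σ≤ N λ v → mult x₁ y₁ u * f u * (mult x₂ y₂ v * g v))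
        ≈⟨ *-congˡ (apply-product (Σ≤-linear N) (Σ≤-linear N) _ _) ⟩
      d * (Σ≤ N (λ u → mult x₁ y₁ u * f u) * Σ≤ N (λ v → mult x₂ y₂ v * g v))
        ≈⟨ pull-back (comult-supported x x₁ x₂) (comult-supported y y₁ y₂) ⟩
      d * ((f ∘mult) (x₁ , y₁) * (g ∘mult) (x₂ , y₂)) ∎
      where
      open *-Solver using (solve; _⊕_; _⊜_)
      d : K
      d = D x₁ x₂ y₁ y₂
      vanishing : ∀ {a b} → d ≈ 0# → d * a ≈ d * b
      vanishing d≈0 = trans (x≈0⇒x*y≈0 _ d≈0) (sym (x≈0⇒x*y≈0 _ d≈0))
      pull-back : deg x₁ +ℕ deg x₂ ≡ dx ⊎ comult x x₁ x₂ ≈ 0# → deg y₁ +ℕ deg y₂ ≡ dy ⊎ comult y y₁ y₂ ≈ 0# →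
        d * (Σ≤ N (λ u → mult x₁ y₁ u * f u) * Σ≤ N (λ v → mult x₂ y₂ v * g v))
          ≈ d * ((f ∘mult) (x₁ , y₁) * (g ∘mult) (x₂ , y₂))
      pull-back (inj₁ x₁₂≡x) (inj₁ y₁₂≡y) = *-congˡ (*-cong
        (mult-Σ≤ x₁ y₁ f (ℕₚ.+-mono-≤ (ℕₚ.m+n≤o⇒m≤o (deg x₁) (ℕₚ.≤-reflexive x₁₂≡x))
                                      (ℕₚ.m+n≤o⇒m≤o (deg y₁) (ℕₚ.≤-reflexive y₁₂≡y))))
        (mult-Σ≤ x₂ y₂ g (ℕₚ.+-mono-≤ (ℕₚ.m+n≤o⇒n≤o (deg x₁) (ℕₚ.≤-reflexive x₁₂≡x))
                                      (ℕₚ.m+n≤o⇒n≤o (deg y₁) (ℕₚ.≤-reflexive y₁₂≡y)))))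
      pull-back (inj₂ Δx≈0) _ = vanishing (x≈0⇒x*y≈0 _ Δx≈0)
      pull-back (inj₁ _) (inj₂ Δy≈0) = vanishing (y≈0⇒x*y≈0 _ Δy≈0)

  ⊗-cong : ∀ {f f′ g g′} → f ≋ f′ → g ≋ g′ → (f ⊗ g) C².≋ (f′ ⊗ g′)
  ⊗-cong f≋f′ g≋g′ (x , y) = *-cong (f≋f′ x) (g≋g′ y)

  ∘mult-cong : ∀ {f g} → f ≋ g → (f ∘mult) C².≋ (g ∘mult)
  ∘mult-cong f≋g (x , y) = Σdeg-cong (deg x +ℕ deg y) (λ c _ → *-congˡ {mult x y c} (f≋g c))

  unital² : ∀ {G} → G (one , one) ≈ 1# → C².Unital G
  unital² G-unit ((zero , Fin.zero) , (zero , Fin.zero)) _ = G-unit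

  ∘mult-unital : ∀ {f} → C.Unital f → C².Unital (f ∘mult)
  ∘mult-unital {f} f-unital = unital² (begin
    mult one one one * f one + 0# ≈⟨ +-identityʳ _ ⟩
    mult one one one * f one      ≈⟨ *-cong (trans (mult-unitˡ one one) (δ-refl one)) (f-unital one ≡.refl) ⟩
    1# * 1#                       ≈⟨ *-identityˡ 1# ⟩
    1#                            ∎)

  ⊗-unital : ∀ {f g} → C.Unital f → C.Unital g → C².Unital (f ⊗ g)
  ⊗-unital f-unital g-unital = unital² (trans (*-cong (f-unital one ≡.refl) (g-unital one ≡.refl)) (*-identityˡ 1#))

module Characters {c ℓ} (k : Field c ℓ) {dim₊ : ℕ → ℕ} (H : Over.GradedConnectedHopfAlgebra k dim₊) where
  open Field k using (_≈_; _*_; _+_; 1#; refl; sym)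
  open Over.HopfAlgebra k H
  open HopfConvolution k H
  open TensorSquare k H
  open import Relation.Binary.Reasoning.Setoid C².≋-setoid

  sandwich-character : ∀ {½} → ½ * (1# + 1#) ≈ 1# → ∀ {φ ψ ρ} → C.Unital ρ → φ ≋ ((ρ ⋆ ψ) ⋆ ρ) →
                       IsCharacter φ → IsCharacter ψ → IsCharacter ρ
  sandwich-character ½·2≈1 {φ} {ψ} {ρ} ρ-unital φ≋ρψρ (_ , φ-mult) (ψ-unit , ψ-mult) =
    ρ-unital one ≡.refl ,
    λ x y → C².sandwich-injective Ψ-unital ½·2≈1 (∘mult-unital ρ-unital) (⊗-unital ρ-unital ρ-unital)
              (Setoid.trans C².≋-setoid pullback-solves (Setoid.sym C².≋-setoid tensor-solves)) (x , y)
    where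
    Ψ-unital : C².Unital (ψ ∘mult)
    Ψ-unital = ∘mult-unital (unit-unital {ψ} ψ-unit)

    pullback-solves : C².sandwich Ψ-unital (ρ ∘mult) C².≋ (φ ∘mult)
    pullback-solves = begin
      ((ρ ∘mult) C².⋆ (ψ ∘mult)) C².⋆ (ρ ∘mult) ≈⟨ C².⋆-cong (∘mult-⋆ ρ ψ) (λ _ → refl) ⟩
      ((ρ ⋆ ψ) ∘mult) C².⋆ (ρ ∘mult)            ≈⟨ ∘mult-⋆ (ρ ⋆ ψ) ρ ⟩
      (((ρ ⋆ ψ) ⋆ ρ) ∘mult)                     ≈⟨ ∘mult-cong (λ b → sym (φ≋ρψρ b)) ⟩
      (φ ∘mult)                                 ∎

    tensor-solves : C².sandwich Ψ-unital (ρ ⊗ ρ) C².≋ (φ ∘mult)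
    tensor-solves = begin
      ((ρ ⊗ ρ) C².⋆ (ψ ∘mult)) C².⋆ (ρ ⊗ ρ) ≈⟨ C².⋆-cong (C².⋆-cong (λ _ → refl) (λ (x , y) → ψ-mult x y)) (λ _ → refl) ⟩
      ((ρ ⊗ ρ) C².⋆ (ψ ⊗ ψ)) C².⋆ (ρ ⊗ ρ)   ≈⟨ C².⋆-cong (⊗-⋆ ρ ρ ψ ψ) (λ _ → refl) ⟩
      ((ρ ⋆ ψ) ⊗ (ρ ⋆ ψ)) C².⋆ (ρ ⊗ ρ)       ≈⟨ ⊗-⋆ (ρ ⋆ ψ) (ρ ⋆ ψ) ρ ρ ⟩
      ((ρ ⋆ ψ) ⋆ ρ) ⊗ ((ρ ⋆ ψ) ⋆ ρ)           ≈⟨ ⊗-cong (λ b → sym (φ≋ρψρ b)) (λ b → sym (φ≋ρψρ b)) ⟩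
      φ ⊗ φ                                   ≈⟨ (λ (x , y) → sym (φ-mult x y)) ⟩
      (φ ∘mult)                               ∎

proposition1p4 : ∀ {c ℓ} (k : Field c ℓ) → Over.CharNot2 k →
    (dim₊ : ℕ → ℕ) (H : Over.GradedConnectedHopfAlgebra k dim₊) →
    let open Over.HopfAlgebra k H in
    (φ ψ : Functional) → RestrictsToε φ → RestrictsToε ψ →
    Σ Functional (λ ρ →
      -- (a) existence
      (RestrictsToε ρ × (φ ≋ ((ρ ⋆ ψ) ⋆ ρ)))
      -- (a) uniqueness
      × (∀ ρ′ → RestrictsToε ρ′ → φ ≋ ((ρ′ ⋆ ψ) ⋆ ρ′) → ρ′ ≋ ρ)
      -- (b)
      × (IsCharacter φ → IsCharacter ψ → IsCharacter ρ)
      -- (c)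
      × (IsInverse ψ (bar φ) → IsEven ρ)
      × ((bar φ ≋ ψ) → IsOdd ρ))
proposition1p4 k 2≉0 dim₊ H φ ψ φ₀≈ε ψ₀≈ε =
  ρ , (unital⇒restricts ρ-unital , φ≋ρψρ) , (λ ρ′ ρ′₀≈ε → unique (restricts⇒unital ρ′₀≈ε)) ,
  sandwich-character ½·2≈1 ρ-unital φ≋ρψρ ,
  (λ ψφ̄≋ε → sandwich-even ρ-unital φ≋ρψρ unique (proj₁ ψφ̄≋ε)) , sandwich-odd ρ-unital φ≋ρψρ unique
  where
  open Field k
  open Over.HopfAlgebra k H
  open HopfConvolution k H
  open SandwichParity k H
  open Characters k H

  ½ : Carrier
  ½ = proj₁ (inverse (1# + 1#) 2≉0)

  ½·2≈1 : ½ * (1# + 1#) ≈ 1#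
  ½·2≈1 = trans (*-comm _ _) (proj₂ (inverse (1# + 1#) 2≉0))

  ψ-unital : C.Unital ψ
  ψ-unital = restricts⇒unital ψ₀≈ε

  solution : Σ Functional (λ ρ → C.Unital ρ × ((ρ ⋆ ψ) ⋆ ρ) ≋ φ)
  solution = C.sandwich-surjective ψ-unital ½·2≈1 (restricts⇒unital φ₀≈ε)

  ρ : Functional
  ρ = proj₁ solution

  ρ-unital : C.Unital ρ
  ρ-unital = proj₁ (proj₂ solution)

  φ≋ρψρ : φ ≋ ((ρ ⋆ ψ) ⋆ ρ)
  φ≋ρψρ b = sym (proj₂ (proj₂ solution) b)

  unique : ∀ {ρ′} → C.Unital ρ′ → φ ≋ ((ρ′ ⋆ ψ) ⋆ ρ′) → ρ′ ≋ ρ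
  unique ρ′-unital φ≋ρ′ψρ′ =
    C.sandwich-injective ψ-unital ½·2≈1 ρ′-unital ρ-unital (λ b → trans (sym (φ≋ρ′ψρ′ b)) (φ≋ρψρ b))
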